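{- Let $L$ be a finite semidistributive lattice and let $\equiv$ be a congruence of $L$. Then $\mathrm{UJI}_\equiv = \kappa_\vee(\mathrm{UMI}_\equiv)$ and $\mathrm{UMI}_\equiv = \kappa_\wedge(\mathrm{UJI}_\equiv)$. Consequently, $\kappa_\vee$ and $\kappa_\wedge$ induce mutually inverse isomorphisms between the simplicial complexes $\mathrm{CMC}_\equiv$ and $\mathrm{CJC}_\equiv$.
   Context: $L$ is a finite lattice with join $\vee$ and meet $\wedge$. An element $j$ is join irreducible if it covers exactly one element, denoted $j_\star$; an element $m$ is meet irreducible if it is covered by exactly one element, denoted $m^\star$. Let $\mathrm{JI}(L)$, $\mathrm{MI}(L)$ be the sets of join, resp. meet, irreducible elements. A join representation of $x$ is a set $J$ with $\bigvee J=x$, irredundant if no proper subset has join $x$; irredundant join representations are ordered by $J\le J'$ iff each element of $J$ is below some element of $J'$, and the canonical join representation $\mathrm{CJR}(x)$ is the minimum one if it exists. Dually, the canonical meet representation $\mathrm{CMR}(x)$ is the irredundant meet representation $M$ of $x$ such that for every irredundant meet representation $M'$ of $x$, every element of $M$ is above some element of $M'$. $L$ is semidistributive if every element has both a canonical join and a canonical meet representation; then $\mathrm{CJR}(x)\subseteq\mathrm{JI}(L)$ and $\mathrm{CMR}(x)\subseteq\mathrm{MI}(L)$. The canonical join complex $\mathrm{CJC}(L)$ is the simplicial complex on $\mathrm{JI}(L)$ whose faces are the sets $\mathrm{CJR}(x)$, $x\in L$; the canonical meet complex $\mathrm{CMC}(L)$ is defined dually on $\mathrm{MI}(L)$. For $m\in\mathrm{MI}(L)$,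 $\kappa_\vee(m)$ is the unique minimal element of $\{z\in L : z\le m^\star,\ z\not\le m\}$; for $j\in\mathrm{JI}(L)$, $\kappa_\wedge(j)$ is the unique maximal element of $\{z\in L: z\ge j_\star,\ z\not\ge j\}$. In a finite semidistributive lattice these exist and $\kappa_\vee:\mathrm{MI}(L)\to\mathrm{JI}(L)$, $\kappa_\wedge:\mathrm{JI}(L)\to\mathrm{MI}(L)$ are inverse bijections. A congruence of $L$ is an equivalence relation $\equiv$ with $x\equiv x',y\equiv y'\Rightarrow x\vee y\equiv x'\vee y'$ and $x\wedge y\equiv x'\wedge y'$. $\mathrm{UJI}_\equiv$ is the set of $j\in\mathrm{JI}(L)$ with $j\not\equiv j_\star$, and $\mathrm{UMI}_\equiv$ the set of $m\in\mathrm{MI}(L)$ with $m\not\equiv m^\star$. $\mathrm{CJC}_\equiv$ (resp. $\mathrm{CMC}_\equiv$) is the subcomplex of $\mathrm{CJC}(L)$ (resp. $\mathrm{CMC}(L)$) consisting of the faces contained in $\mathrm{UJI}_\equiv$ (resp. $\mathrm{UMI}_\equiv$). -}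

module Defs where

open import Level using (0ℓ)
open import Data.List using (List; foldr)
open import Data.List.Membership.Propositional using (_∈_)
open import Data.List.Relation.Binary.Subset.Propositional using (_⊆_)
open import Data.Product using (Σ; ∃; ∃-syntax; _×_; _,_; proj₁)
open import Relation.Nullary using (¬_)
open import Relation.Binary.Core using (Rel)
open import Relation.Binary.Definitions using (Decidable; DecidableEquality)
open import Relation.Binary.Structures using (IsEquivalence)
open import Relation.Binary.PropositionalEquality using (_≡_)
open import Relation.Binary.Lattice.Structures using (IsBoundedLattice)

-- A finite lattice: carrier with propositional equality, a partial order
-- with joins/meets (bounded, as every nonempty finite lattice is), an
-- exhaustive list of elements, and decidable equality / order.
record FinLattice : Set₁ where
  infixr 6 _∨_
  infixr 7 _∧_
  infix 4 _≤_
  field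
    Carrier          : Set
    _≤_              : Rel Carrier 0ℓ
    _∨_ _∧_          : Carrier → Carrier → Carrier
    ⊤ ⊥              : Carrier
    isBoundedLattice : IsBoundedLattice _≡_ _≤_ _∨_ _∧_ ⊤ ⊥
    elements         : List Carrier
    complete         : ∀ x → x ∈ elements
    _≟_              : DecidableEquality Carrier
    _≤?_             : Decidable _≤_

module Theory (L : FinLattice) where
  open FinLattice L

  infix 4 _<_ _⋖_

  _<_ : Rel Carrier 0ℓ
  x < y = x ≤ y × ¬ x ≡ y

  _⋖_ : Rel Carrier 0ℓ
  x ⋖ y = x < y × (∀ z → x < z → ¬ z < y)

  -- j covers exactly one element (that element, the first component, is j_⋆)
  IsJI : Carrier → Set
  IsJI j = Σ Carrier λ a → a ⋖ j × (∀ b → b ⋖ j → b ≡ a)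

  -- m is covered by exactly one element (first component is m^⋆)
  IsMI : Carrier → Set
  IsMI m = Σ Carrier λ b → m ⋖ b × (∀ c → m ⋖ c → c ≡ b)

  ⋁ : List Carrier → Carrier
  ⋁ = foldr _∨_ ⊥

  ⋀ : List Carrier → Carrier
  ⋀ = foldr _∧_ ⊤

  IrrJoinRep : Carrier → List Carrier → Set
  IrrJoinRep x J = ⋁ J ≡ x × (∀ J' → J' ⊆ J → ¬ (J ⊆ J') → ¬ ⋁ J' ≡ x)

  IrrMeetRep : Carrier → List Carrier → Set
  IrrMeetRep x M = ⋀ M ≡ x × (∀ M' → M' ⊆ M → ¬ (M ⊆ M') → ¬ ⋀ M' ≡ x)

  _≼_ : List Carrier → List Carrier → Set
  J ≼ J' = ∀ j → j ∈ J → ∃[ j' ] (j' ∈ J' × j ≤ j')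

  IsCJR : Carrier → List Carrier → Set
  IsCJR x J = IrrJoinRep x J × (∀ J' → IrrJoinRep x J' → J ≼ J')

  IsCMR : Carrier → List Carrier → Set
  IsCMR x M = IrrMeetRep x M ×
              (∀ M' → IrrMeetRep x M' → ∀ m → m ∈ M → ∃[ m' ] (m' ∈ M' × m' ≤ m))

  Semidistributive : Set
  Semidistributive = ∀ x → (∃[ J ] IsCJR x J) × (∃[ M ] IsCMR x M)

  IsMinimal : (Carrier → Set) → Carrier → Set
  IsMinimal S z = S z × (∀ w → S w → w ≤ z → w ≡ z)

  IsMaximal : (Carrier → Set) → Carrier → Set
  IsMaximal S z = S z × (∀ w → S w → z ≤ w → w ≡ z)

  IsUniqueMinimal : (Carrier → Set) → Carrier → Set
  IsUniqueMinimal S z = IsMinimal S z × (∀ w → IsMinimal S w → w ≡ z)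

  IsUniqueMaximal : (Carrier → Set) → Carrier → Set
  IsUniqueMaximal S z = IsMaximal S z × (∀ w → IsMaximal S w → w ≡ z)

  -- KappaJoin m j  :  m ∈ MI(L) and j = κ_∨(m)
  KappaJoin : Carrier → Carrier → Set
  KappaJoin m j = Σ (IsMI m) λ p →
    IsUniqueMinimal (λ z → z ≤ proj₁ p × ¬ z ≤ m) j

  -- KappaMeet j m  :  j ∈ JI(L) and m = κ_∧(j)
  KappaMeet : Carrier → Carrier → Set
  KappaMeet j m = Σ (IsJI j) λ p →
    IsUniqueMaximal (λ z → proj₁ p ≤ z × ¬ j ≤ z) m

  record IsCongruence (Θ : Rel Carrier 0ℓ) : Set where
    field
      isEquivalence : IsEquivalence Θ
      ∨-cong : ∀ {x x' y y'} → Θ x x' → Θ y y' → Θ (x ∨ y) (x' ∨ y')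
      ∧-cong : ∀ {x x' y y'} → Θ x x' → Θ y y' → Θ (x ∧ y) (x' ∧ y')

  UJI : Rel Carrier 0ℓ → Carrier → Set
  UJI Θ j = Σ (IsJI j) λ p → ¬ Θ j (proj₁ p)

  UMI : Rel Carrier 0ℓ → Carrier → Set
  UMI Θ m = Σ (IsMI m) λ p → ¬ Θ m (proj₁ p)

  IsCJCFace : Rel Carrier 0ℓ → List Carrier → Set
  IsCJCFace Θ F = (∃[ x ] IsCJR x F) × (∀ j → j ∈ F → UJI Θ j)

  IsCMCFace : Rel Carrier 0ℓ → List Carrier → Set
  IsCMCFace Θ F = (∃[ x ] IsCMR x F) × (∀ m → m ∈ F → UMI Θ m)

  -- B is the image of A under the relation R (R a b read "b = f(a)")
  Image : (Carrier → Carrier → Set) → List Carrier → List Carrier → Set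
  Image R A B = (∀ b → b ∈ B → ∃[ a ] (a ∈ A × R a b)) ×
                (∀ a → a ∈ A → ∃[ b ] (b ∈ B × R a b))

-- Semidistributivity makes κ_∨(m) the least element of {z ≤ m^⋆ : z ≰ m} and
-- m the greatest element of {z ≥ j_⋆ : j ≰ z} for j = κ_∨(m); hence κ_∨ and
-- κ_∧ are mutually inverse. For such a pair, m ∨ j = m^⋆ and m ∨ j_⋆ = m, and
-- dually j ∧ m^⋆ = j and j ∧ m = j_⋆, so a congruence collapses j_⋆ ⋖ j exactly
-- when it collapses m ⋖ m^⋆. If M is the canonical meet representation of x,
-- then κ_∨(a') ≤ a for distinct a, a' ∈ M; so every j = κ_∨(a) in the image J
-- satisfies j ≰ j_⋆ ∨ ⋁(J ∖ j), which characterises canonical join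
-- representations. The statements about κ_∧ follow in the dual lattice.

module Submission where

open import Defs
open import Level using (0ℓ)
open import Data.List using (List; []; _∷_; filter)
open import Data.List.Membership.Propositional using (_∈_; _∉_; find)
open import Data.List.Membership.Propositional.Properties using (∈-filter⁺; ∈-filter⁻)
open import Data.List.Relation.Binary.Subset.Propositional using (_⊆_)
open import Data.List.Relation.Unary.Any using (here; there)
import Data.List.Relation.Unary.All as All
open import Data.List.Relation.Unary.All.Properties using (¬All⇒Any¬)
open import Data.Product using (Σ; ∃-syntax; _×_; _,_; proj₁; proj₂; swap; map; map₂)
open import Data.Empty using (⊥-elim)
open import Function using (flip; _∘_; _∘₂_)
open import Function.Bundles using (_⇔_; mk⇔; Equivalence)
open import Relation.Nullary using (¬_; yes; no; ¬?; _×-dec_)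
open import Relation.Nullary.Decidable using (decidable-stable)
import Relation.Unary as U
open import Relation.Binary.Core using (Rel)
open import Relation.Binary.Structures using (IsEquivalence)
open import Relation.Binary.Bundles using (Poset)
open import Relation.Binary.Definitions using (Decidable)
open import Relation.Binary.PropositionalEquality
  using (_≡_; _≢_; refl; sym; trans; cong; subst; subst₂; ≢-sym; module ≡-Reasoning)
open import Relation.Binary.Lattice.Structures using (IsBoundedLattice)
import Relation.Binary.Lattice.Properties.Lattice as LatticeProperties
import Relation.Binary.Reasoning.PartialOrder as PosetReasoning

module FinLatticeProperties (L : FinLattice) where
  open FinLattice L
  open Theory L
  open IsBoundedLattice isBoundedLattice
    using (isPartialOrder; x≤x∨y; y≤x∨y; ∨-least; x∧y≤x; x∧y≤y; ∧-greatest; minimum)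
    renaming (refl to ≤-refl; reflexive to ≤-reflexive; trans to ≤-trans; antisym to ≤-antisym)
  open import Data.List.Membership.DecPropositional _≟_ using (_∈?_)

  poset : Poset 0ℓ 0ℓ 0ℓ
  poset = record { isPartialOrder = isPartialOrder }

  ≤-stable : ∀ {x y} → ¬ ¬ x ≤ y → x ≤ y
  ≤-stable = decidable-stable (_ ≤? _)

  _<?_ : Decidable _<_
  x <? y = (x ≤? y) ×-dec ¬? (x ≟ y)

  <⇒≱ : ∀ {x y} → x < y → ¬ y ≤ x
  <⇒≱ (x≤y , x≢y) y≤x = x≢y (≤-antisym x≤y y≤x)

  ≰⇒<∨ : ∀ {x z} → ¬ z ≤ x → x < x ∨ z
  ≰⇒<∨ z≰x = x≤x∨y _ _ , λ x≡x∨z → z≰x (subst (_ ≤_) (sym x≡x∨z) (y≤x∨y _ _))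

  ≰⇒∧< : ∀ {x z} → ¬ x ≤ z → x ∧ z < x
  ≰⇒∧< x≰z = x∧y≤x _ _ , λ x∧z≡x → x≰z (subst (_≤ _) x∧z≡x (x∧y≤y _ _))

  y≤x⇒x∨y≡x : ∀ {x y} → y ≤ x → x ∨ y ≡ x
  y≤x⇒x∨y≡x y≤x = ≤-antisym (∨-least ≤-refl y≤x) (x≤x∨y _ _)

  private
    module _ {P : Carrier → Set} (P? : U.Decidable P) where

      climb : Carrier → List Carrier → Carrier
      climb b []       = b
      climb b (y ∷ ys) with P? y | b ≤? y
      ... | yes _ | yes _ = climb y ys
      ... | yes _ | no  _ = climb b ys
      ... | no  _ | _     = climb b ys

      climb-P : ∀ {b} ys → P b → P (climb b ys)
      climb-P []               Pb = Pb
      climb-P {b} (y ∷ ys) Pb with P? y | b ≤? y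
      ... | yes Py | yes _ = climb-P ys Py
      ... | yes _  | no  _ = climb-P ys Pb
      ... | no  _  | _     = climb-P ys Pb

      climb-≥ : ∀ b ys → b ≤ climb b ys
      climb-≥ b []       = ≤-refl
      climb-≥ b (y ∷ ys) with P? y | b ≤? y
      ... | yes _ | yes b≤y = ≤-trans b≤y (climb-≥ y ys)
      ... | yes _ | no  _   = climb-≥ b ys
      ... | no  _ | _       = climb-≥ b ys

      climb-maximal : ∀ {b w} ys → P b → w ∈ ys → P w → climb b ys ≤ w → w ≡ climb b ys
      climb-maximal {b} (y ∷ ys) Pb (here refl) Py climb≤y with P? y | b ≤? y
      ... | yes _   | yes _   = ≤-antisym (climb-≥ y ys) climb≤y
      ... | yes _   | no  b≰y = ⊥-elim (b≰y (≤-trans (climb-≥ b ys) climb≤y))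
      ... | no  ¬Py | _       = ⊥-elim (¬Py Py)
      climb-maximal {b} (y ∷ ys) Pb (there w∈ys) Pw climb≤w with P? y | b ≤? y
      ... | yes Py | yes _ = climb-maximal ys Py w∈ys Pw climb≤w
      ... | yes _  | no  _ = climb-maximal ys Pb w∈ys Pw climb≤w
      ... | no  _  | _     = climb-maximal ys Pb w∈ys Pw climb≤w

  maximal-above : ∀ {P : Carrier → Set} → U.Decidable P →
                  ∀ {x} → P x → ∃[ z ] (x ≤ z × IsMaximal P z)
  maximal-above P? {x} Px =
    climb P? x elements , climb-≥ P? x elements , climb-P P? elements Px ,
    λ w Pw z≤w → climb-maximal P? elements Px (complete w) Pw z≤w

  cover-between : ∀ {z y} → z < y → ∃[ c ] (z ≤ c × c ⋖ y)
  cover-between {z} {y} z<y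
    with maximal-above (λ c → (z ≤? c) ×-dec (c <? y)) (≤-refl , z<y)
  ... | c , z≤c , (_ , c<y) , maximal =
    c , z≤c , c<y , λ u c<u u<y →
      proj₂ c<u (sym (maximal u (≤-trans z≤c (proj₁ c<u) , u<y) (proj₁ c<u)))

  lowerCover< : ∀ {j} (q : IsJI j) → proj₁ q < j
  lowerCover< (_ , (j₋<j , _) , _) = j₋<j

  <⇒≤lowerCover : ∀ {j z} (q : IsJI j) → z < j → z ≤ proj₁ q
  <⇒≤lowerCover {z = z} (_ , _ , unique) z<j with cover-between z<j
  ... | c , z≤c , c⋖j = subst (z ≤_) (unique c c⋖j) z≤c

  lowerCover-unique : ∀ {j} (q q' : IsJI j) → proj₁ q ≡ proj₁ q'
  lowerCover-unique (_ , j₋⋖j , _) (_ , _ , unique) = unique _ j₋⋖j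

  greatest-below⇒JI : ∀ {a j} → a < j → (∀ {z} → z < j → z ≤ a) → IsJI j
  greatest-below⇒JI {a} a<j below =
    a , (a<j , λ z a<z z<j → <⇒≱ a<z (below z<j)) ,
    λ b (b<j , b⋖j) → decidable-stable (b ≟ a) λ b≢a → b⋖j a (below b<j , b≢a) a<j

  ⋁-upperBound : ∀ {x} J → x ∈ J → x ≤ ⋁ J
  ⋁-upperBound (_ ∷ _) (here refl) = x≤x∨y _ _
  ⋁-upperBound (_ ∷ J) (there x∈J) = ≤-trans (⋁-upperBound J x∈J) (y≤x∨y _ _)

  ⋁-least : ∀ J {z} → (∀ {x} → x ∈ J → x ≤ z) → ⋁ J ≤ z
  ⋁-least []      _     = minimum _
  ⋁-least (_ ∷ J) bound = ∨-least (bound (here refl)) (⋁-least J (bound ∘ there))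

  ⋁-mono : ∀ {J K} → J ⊆ K → ⋁ J ≤ ⋁ K
  ⋁-mono {J} {K} J⊆K = ⋁-least J (⋁-upperBound K ∘ J⊆K)

  ⋁-pair : ∀ x y → ⋁ (x ∷ y ∷ []) ≡ x ∨ y
  ⋁-pair x y = cong (x ∨_) (y≤x⇒x∨y≡x (minimum y))

  ⋁-squeeze : ∀ {J K R x} → J ⊆ K → K ⊆ R → ⋁ J ≡ x → ⋁ R ≡ x → ⋁ K ≡ x
  ⋁-squeeze J⊆K K⊆R refl ⋁R≡⋁J = ≤-antisym (subst (_ ≤_) ⋁R≡⋁J (⋁-mono K⊆R)) (⋁-mono J⊆K)

  infixl 6 _∖_

  opaque
    _∖_ : List Carrier → Carrier → List Carrier
    J ∖ j = filter (λ y → ¬? (y ≟ j)) J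

    ∖-⊆ : ∀ {J j} → J ∖ j ⊆ J
    ∖-⊆ {J} {j} = proj₁ ∘ ∈-filter⁻ (λ y → ¬? (y ≟ j)) {xs = J}

    ∈-∖⁻ : ∀ {J j y} → y ∈ J ∖ j → y ≢ j
    ∈-∖⁻ {J} {j} = proj₂ ∘ ∈-filter⁻ (λ y → ¬? (y ≟ j)) {xs = J}

    ∈-∖⁺ : ∀ {J j y} → y ∈ J → y ≢ j → y ∈ J ∖ j
    ∈-∖⁺ {j = j} = ∈-filter⁺ (λ y → ¬? (y ≟ j))

  ∉-∖ : ∀ {J j} → j ∉ J ∖ j
  ∉-∖ j∈J∖j = ∈-∖⁻ j∈J∖j refl

  ⊆-∖ : ∀ {J K j} → J ⊆ K → j ∉ J → J ⊆ K ∖ j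
  ⊆-∖ J⊆K j∉J y∈J = ∈-∖⁺ (J⊆K y∈J) λ { refl → j∉J y∈J }

  ∖-mono : ∀ {J K j} → J ⊆ K → J ∖ j ⊆ K ∖ j
  ∖-mono J⊆K y∈J∖j = ∈-∖⁺ (J⊆K (∖-⊆ y∈J∖j)) (∈-∖⁻ y∈J∖j)

  ⋁-least-∖ : ∀ {J j z} → j ≤ z → ⋁ (J ∖ j) ≤ z → ⋁ J ≤ z
  ⋁-least-∖ {J} {j} {z} j≤z rest≤z = ⋁-least J bound
    where
    bound : ∀ {y} → y ∈ J → y ≤ z
    bound {y} y∈J with y ≟ j
    ... | yes refl = j≤z
    ... | no  y≢j  = ≤-trans (⋁-upperBound (J ∖ j) (∈-∖⁺ y∈J y≢j)) rest≤z

  ⊈⇒∃∉ : ∀ {J K} → ¬ J ⊆ K → ∃[ j ] (j ∈ J × j ∉ K)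
  ⊈⇒∃∉ {J} {K} J⊈K = find (¬All⇒Any¬ (_∈? K) J λ all → J⊈K (All.lookup all))

  irredundant⁺ : ∀ {x J} → ⋁ J ≡ x → (∀ {j} → j ∈ J → ⋁ (J ∖ j) ≢ x) → IrrJoinRep x J
  irredundant⁺ ⋁J≡x nonredundant = ⋁J≡x , λ J' J'⊆J J⊈J' ⋁J'≡x →
    let j , j∈J , j∉J' = ⊈⇒∃∉ J⊈J'
    in nonredundant j∈J (⋁-squeeze (⊆-∖ J'⊆J j∉J') ∖-⊆ ⋁J'≡x ⋁J≡x)

  irredundant⁻ : ∀ {x J j} → IrrJoinRep x J → j ∈ J → ⋁ (J ∖ j) ≢ x
  irredundant⁻ (_ , irredundant) j∈J = irredundant _ ∖-⊆ λ J⊆J∖j → ∉-∖ (J⊆J∖j j∈J)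

  private
    module _ (x : Carrier) where

      prune : List Carrier → List Carrier → List Carrier
      prune []       K = K
      prune (r ∷ rs) K with ⋁ (K ∖ r) ≟ x
      ... | yes _ = prune rs (K ∖ r)
      ... | no  _ = prune rs K

      prune-⊆ : ∀ rs {K} → prune rs K ⊆ K
      prune-⊆ []           y∈ = y∈
      prune-⊆ (r ∷ rs) {K} y∈ with ⋁ (K ∖ r) ≟ x
      ... | yes _ = ∖-⊆ (prune-⊆ rs y∈)
      ... | no  _ = prune-⊆ rs y∈

      prune-⋁ : ∀ rs {K} → ⋁ K ≡ x → ⋁ (prune rs K) ≡ x
      prune-⋁ []           ⋁K≡x = ⋁K≡x
      prune-⋁ (r ∷ rs) {K} ⋁K≡x with ⋁ (K ∖ r) ≟ x
      ... | yes ⋁K∖r≡x = prune-⋁ rs ⋁K∖r≡x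
      ... | no  _      = prune-⋁ rs ⋁K≡x

      prune-nonredundant : ∀ rs {K j} → ⋁ K ≡ x → j ∈ rs → j ∈ prune rs K →
                           ⋁ (prune rs K ∖ j) ≢ x
      prune-nonredundant (r ∷ rs) {K} ⋁K≡x (here refl) r∈S with ⋁ (K ∖ r) ≟ x
      ... | yes _      = ⊥-elim (∉-∖ (prune-⊆ rs r∈S))
      ... | no  ⋁K∖r≢x = λ ⋁S∖r≡x → ⋁K∖r≢x (⋁-squeeze (∖-mono (prune-⊆ rs)) ∖-⊆ ⋁S∖r≡x ⋁K≡x)
      prune-nonredundant (r ∷ rs) {K} ⋁K≡x (there j∈rs) j∈S with ⋁ (K ∖ r) ≟ x
      ... | yes ⋁K∖r≡x = prune-nonredundant rs ⋁K∖r≡x j∈rs j∈S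
      ... | no  _      = prune-nonredundant rs ⋁K≡x j∈rs j∈S

  irredundant-subrepresentation : ∀ {x R} → ⋁ R ≡ x → ∃[ R' ] (R' ⊆ R × IrrJoinRep x R')
  irredundant-subrepresentation {x} {R} ⋁R≡x =
    prune x R R , prune-⊆ x R ,
    irredundant⁺ (prune-⋁ x R ⋁R≡x) λ j∈S → prune-nonredundant x R ⋁R≡x (prune-⊆ x R j∈S) j∈S

  CJR-refines : ∀ {x K R} → IsCJR x K → ⋁ R ≡ x → K ≼ R
  CJR-refines (_ , least) ⋁R≡x k k∈K =
    let R' , R'⊆R , irredundant = irredundant-subrepresentation ⋁R≡x
        r , r∈R' , k≤r = least R' irredundant k k∈K
    in r , R'⊆R r∈R' , k≤r

  CJR⇒∨-semidistributive : ∀ {x y z} → ∃[ K ] IsCJR (x ∨ y) K →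
                            x ∨ y ≡ x ∨ z → x ∨ (y ∧ z) ≡ x ∨ y
  CJR⇒∨-semidistributive {x} {y} {z} (K , cjr@((⋁K≡x∨y , _) , _)) x∨y≡x∨z =
    ≤-antisym (∨-least (x≤x∨y _ _) (≤-trans (x∧y≤x _ _) (y≤x∨y _ _)))
              (subst (_≤ _) ⋁K≡x∨y (⋁-least K bound))
    where
    bound : ∀ {k} → k ∈ K → k ≤ x ∨ (y ∧ z)
    bound {k} k∈K with CJR-refines {R = x ∷ y ∷ []} cjr (⋁-pair x y) k k∈K
                     | CJR-refines {R = x ∷ z ∷ []} cjr (trans (⋁-pair x z) (sym x∨y≡x∨z)) k k∈K
    ... | _ , here refl , k≤x         | _                         = ≤-trans k≤x (x≤x∨y _ _)
    ... | _ , there (here refl) , _   | _ , here refl , k≤x       = ≤-trans k≤x (x≤x∨y _ _)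
    ... | _ , there (here refl) , k≤y | _ , there (here refl) , k≤z =
      ≤-trans (∧-greatest k≤y k≤z) (y≤x∨y _ _)
    ... | _ , there (there ()) , _    | _
    ... | _ , there (here refl) , _   | _ , there (there ()) , _

  CJR⇒≰lowerCover∨rest : ∀ {x J j} → IsCJR x J → j ∈ J → (q : IsJI j) →
                         ¬ j ≤ proj₁ q ∨ ⋁ (J ∖ j)
  CJR⇒≰lowerCover∨rest {x} {J} {j} cjr@(irredundant@(⋁J≡x , _) , _) j∈J q j≤j₋∨rest =
    no-upper-bound (CJR-refines {R = proj₁ q ∷ J ∖ j} cjr ⋁[j₋∷rest]≡x j j∈J)
    where
    j≤x : j ≤ x
    j≤x = subst (j ≤_) ⋁J≡x (⋁-upperBound J j∈J)

    rest≤x : ⋁ (J ∖ j) ≤ x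
    rest≤x = subst (_ ≤_) ⋁J≡x (⋁-mono ∖-⊆)

    ⋁[j₋∷rest]≡x : proj₁ q ∨ ⋁ (J ∖ j) ≡ x
    ⋁[j₋∷rest]≡x = ≤-antisym (∨-least (≤-trans (proj₁ (lowerCover< q)) j≤x) rest≤x)
                             (subst (_≤ _) ⋁J≡x (⋁-least-∖ j≤j₋∨rest (y≤x∨y _ _)))

    no-upper-bound : ¬ (∃[ r ] (r ∈ proj₁ q ∷ J ∖ j × j ≤ r))
    no-upper-bound (_ , here refl , j≤j₋)   = <⇒≱ (lowerCover< q) j≤j₋
    no-upper-bound (_ , there r∈rest , j≤r) = irredundant⁻ irredundant j∈J (≤-antisym rest≤x
      (subst (_≤ _) ⋁J≡x (⋁-least-∖ (≤-trans j≤r (⋁-upperBound _ r∈rest)) ≤-refl)))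

  ≰lowerCover∨rest⇒CJR : ∀ {J} → ∃[ K ] IsCJR (⋁ J) K →
                         (∀ {j} → j ∈ J → Σ (IsJI j) λ q → ¬ j ≤ proj₁ q ∨ ⋁ (J ∖ j)) →
                         IsCJR (⋁ J) J
  ≰lowerCover∨rest⇒CJR {J} (K , (⋁K≡⋁J , _) , leastK) criterion = irredundantJ , least
    where
    irredundantJ : IrrJoinRep (⋁ J) J
    irredundantJ = irredundant⁺ refl λ j∈J ⋁J∖j≡⋁J → proj₂ (criterion j∈J)
      (≤-trans (⋁-upperBound J j∈J) (≤-trans (≤-reflexive (sym ⋁J∖j≡⋁J)) (y≤x∨y _ _)))

    least : ∀ J' → IrrJoinRep (⋁ J) J' → J ≼ J'
    least J' irredundantJ' j j∈J with j ∈? K | criterion j∈J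
    ... | yes j∈K | _              = leastK J' irredundantJ' j j∈K
    ... | no  j∉K | q , j≰j₋∨rest =
      ⊥-elim (j≰j₋∨rest (≤-trans (⋁-upperBound J j∈J) (subst (_≤ _) ⋁K≡⋁J (⋁-least K below))))
      where
      below : ∀ {k} → k ∈ K → k ≤ proj₁ q ∨ ⋁ (J ∖ j)
      below {k} k∈K with leastK J irredundantJ k k∈K
      ... | j' , j'∈J , k≤j' with j' ≟ j
      ... | yes refl = ≤-trans (<⇒≤lowerCover q (k≤j' , λ { refl → j∉K k∈K })) (x≤x∨y _ _)
      ... | no  j'≢j = ≤-trans k≤j' (≤-trans (⋁-upperBound _ (∈-∖⁺ j'∈J j'≢j)) (y≤x∨y _ _))

dual : FinLattice → FinLattice
dual L = record
  { Carrier = Carrier ; _≤_ = flip _≤_ ; _∨_ = _∧_ ; _∧_ = _∨_ ; ⊤ = ⊥ ; ⊥ = ⊤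
  ; isBoundedLattice = record
      { isLattice = LatticeProperties.∧-∨-isLattice (record { isLattice = isLattice })
      ; maximum   = minimum
      ; minimum   = maximum
      }
  ; elements = elements ; complete = complete ; _≟_ = _≟_ ; _≤?_ = flip _≤?_
  }
  where
  open FinLattice L
  open IsBoundedLattice isBoundedLattice using (isLattice; maximum; minimum)

module CoverDuality (L : FinLattice) where
  open Theory L
  private module Lᵒᵖ = Theory (dual L)

  ⋖⇒⋖ᵒᵖ : ∀ {x y} → x ⋖ y → y Lᵒᵖ.⋖ x
  ⋖⇒⋖ᵒᵖ ((x≤y , x≢y) , tight) =
    (x≤y , ≢-sym x≢y) , λ z (z≤y , y≢z) (x≤z , z≢x) → tight z (x≤z , ≢-sym z≢x) (z≤y , ≢-sym y≢z)

-- dual (dual L) is definitionally L as far as Theory is concerned, so each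
-- conversion into the dual, instantiated at dual L, is the conversion back.
module Duality (L : FinLattice) where
  open FinLattice L
  open Theory L
  private module Lᵒᵖ = Theory (dual L)
  open CoverDuality L using (⋖⇒⋖ᵒᵖ)
  open CoverDuality (dual L) using () renaming (⋖⇒⋖ᵒᵖ to ⋖ᵒᵖ⇒⋖)

  JI⇒MIᵒᵖ : ∀ {j} → IsJI j → Lᵒᵖ.IsMI j
  JI⇒MIᵒᵖ (j₋ , j₋⋖j , unique) = j₋ , ⋖⇒⋖ᵒᵖ j₋⋖j , λ c j⋖c → unique c (⋖ᵒᵖ⇒⋖ j⋖c)

  MI⇒JIᵒᵖ : ∀ {m} → IsMI m → Lᵒᵖ.IsJI m
  MI⇒JIᵒᵖ (m⁺ , m⋖m⁺ , unique) = m⁺ , ⋖⇒⋖ᵒᵖ m⋖m⁺ , λ c c⋖m → unique c (⋖ᵒᵖ⇒⋖ c⋖m)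

  KappaMeet⇒KappaJoinᵒᵖ : ∀ {j m} → KappaMeet j m → Lᵒᵖ.KappaJoin j m
  KappaMeet⇒KappaJoinᵒᵖ (q , greatest) = JI⇒MIᵒᵖ q , greatest

  KappaJoin⇒KappaMeetᵒᵖ : ∀ {m j} → KappaJoin m j → Lᵒᵖ.KappaMeet m j
  KappaJoin⇒KappaMeetᵒᵖ (p , least) = MI⇒JIᵒᵖ p , least

  UJI⇒UMIᵒᵖ : ∀ {Θ j} → UJI Θ j → Lᵒᵖ.UMI Θ j
  UJI⇒UMIᵒᵖ (q , ¬θ) = JI⇒MIᵒᵖ q , ¬θ

  UMI⇒UJIᵒᵖ : ∀ {Θ m} → UMI Θ m → Lᵒᵖ.UJI Θ m
  UMI⇒UJIᵒᵖ (p , ¬θ) = MI⇒JIᵒᵖ p , ¬θ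

  CJCFace⇒CMCFaceᵒᵖ : ∀ {Θ F} → IsCJCFace Θ F → Lᵒᵖ.IsCMCFace Θ F
  CJCFace⇒CMCFaceᵒᵖ {Θ} (canonical , uncontracted) =
    canonical , λ j j∈F → UJI⇒UMIᵒᵖ {Θ} (uncontracted j j∈F)

  semidistributiveᵒᵖ : Semidistributive → Lᵒᵖ.Semidistributive
  semidistributiveᵒᵖ sd = swap ∘ sd

  congruenceᵒᵖ : ∀ {Θ} → IsCongruence Θ → Lᵒᵖ.IsCongruence Θ
  congruenceᵒᵖ cg = record { isEquivalence = isEquivalence ; ∨-cong = ∧-cong ; ∧-cong = ∨-cong }
    where open IsCongruence cg

  Image-map : ∀ {R R' : Carrier → Carrier → Set} → (∀ {a b} → R a b → R' a b) →
              ∀ {A B} → Image R A B → Image R' A B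
  Image-map f (preimage , image) = map₂ (map₂ f) ∘₂ preimage , map₂ (map₂ f) ∘₂ image

module IrreducibleCovers (L : FinLattice) where
  open FinLattice L
  open Theory L
  open FinLatticeProperties L
  open IsBoundedLattice isBoundedLattice using (∨-least; ∧-greatest)
    renaming (antisym to ≤-antisym)
  private module Lᵒᵖ = FinLatticeProperties (dual L)
  open Duality L using (MI⇒JIᵒᵖ)

  upperCover> : ∀ {m} (p : IsMI m) → m < proj₁ p
  upperCover> (_ , (m<m⁺ , _) , _) = m<m⁺

  upperCover≤ : ∀ {m z} (p : IsMI m) → m < z → proj₁ p ≤ z
  upperCover≤ p (m≤z , m≢z) = Lᵒᵖ.<⇒≤lowerCover (MI⇒JIᵒᵖ p) (m≤z , ≢-sym m≢z)

  upperCover-unique : ∀ {m} (p p' : IsMI m) → proj₁ p ≡ proj₁ p'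
  upperCover-unique p p' = Lᵒᵖ.lowerCover-unique (MI⇒JIᵒᵖ p) (MI⇒JIᵒᵖ p')

  join-upperCover : ∀ {m z} (p : IsMI m) → z ≤ proj₁ p → ¬ z ≤ m → m ∨ z ≡ proj₁ p
  join-upperCover p z≤m⁺ z≰m =
    ≤-antisym (∨-least (proj₁ (upperCover> p)) z≤m⁺) (upperCover≤ p (≰⇒<∨ z≰m))

  meet-lowerCover : ∀ {j z} (q : IsJI j) → proj₁ q ≤ z → ¬ j ≤ z → j ∧ z ≡ proj₁ q
  meet-lowerCover q j₋≤z j≰z =
    ≤-antisym (<⇒≤lowerCover q (≰⇒∧< j≰z)) (∧-greatest (proj₁ (lowerCover< q)) j₋≤z)

module Kappa (L : FinLattice) (sd : Theory.Semidistributive L) where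
  open FinLattice L
  open Theory L
  open FinLatticeProperties L
  open IrreducibleCovers L
  open IsBoundedLattice isBoundedLattice
    using (∨-least; x∧y≤x; x∧y≤y; ∧-greatest)
    renaming (refl to ≤-refl; trans to ≤-trans; antisym to ≤-antisym)
  private module Lᵒᵖ = FinLatticeProperties (dual L)
  open Duality L using (MI⇒JIᵒᵖ)

  ∨-semidistributive : ∀ {x y z} → x ∨ y ≡ x ∨ z → x ∨ (y ∧ z) ≡ x ∨ y
  ∨-semidistributive = CJR⇒∨-semidistributive (proj₁ (sd _))

  ∧-semidistributive : ∀ {x y z} → x ∧ y ≡ x ∧ z → x ∧ (y ∨ z) ≡ x ∧ y
  ∧-semidistributive = Lᵒᵖ.CJR⇒∨-semidistributive (proj₂ (sd _))

  private
    Separating : ∀ {m} → IsMI m → Carrier → Set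
    Separating {m} p z = z ≤ proj₁ p × ¬ z ≤ m

  minimal⇒least : ∀ {m j z} (p : IsMI m) → IsMinimal (Separating p) j → Separating p z → j ≤ z
  minimal⇒least {m} {j} {z} p ((j≤m⁺ , j≰m) , minimal) (z≤m⁺ , z≰m) =
    subst (_≤ z) (minimal (j ∧ z) (≤-trans (x∧y≤x _ _) j≤m⁺ , j∧z≰m) (x∧y≤x _ _)) (x∧y≤y _ _)
    where
    open ≡-Reasoning
    j∧z≰m : ¬ j ∧ z ≤ m
    j∧z≰m j∧z≤m = proj₂ (upperCover> p) (begin
      m            ≡⟨ y≤x⇒x∨y≡x j∧z≤m ⟨
      m ∨ (j ∧ z)  ≡⟨ ∨-semidistributive (trans (join-upperCover p j≤m⁺ j≰m)
                                                (sym (join-upperCover p z≤m⁺ z≰m))) ⟩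
      m ∨ j        ≡⟨ join-upperCover p j≤m⁺ j≰m ⟩
      proj₁ p      ∎)

  κ-exists : ∀ {m} → IsMI m → ∃[ j ] KappaJoin m j
  κ-exists {m} p =
    let j , _ , minimal = Lᵒᵖ.maximal-above separating? (≤-refl , <⇒≱ (upperCover> p))
    in j , p , minimal , λ w minimal-w →
         ≤-antisym (minimal⇒least p minimal-w (proj₁ minimal))
                   (minimal⇒least p minimal (proj₁ minimal-w))
    where
    separating? : U.Decidable (Separating p)
    separating? z = (z ≤? proj₁ p) ×-dec ¬? (z ≤? m)

  κ≰ : ∀ {m j} → KappaJoin m j → ¬ j ≤ m
  κ≰ (_ , ((_ , j≰m) , _) , _) = j≰m

  κ≤upperCover : ∀ {m j} → KappaJoin m j → (p : IsMI m) → j ≤ proj₁ p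
  κ≤upperCover {j = j} (p' , ((j≤m⁺ , _) , _) , _) p = subst (j ≤_) (upperCover-unique p' p) j≤m⁺

  κ-least : ∀ {m j z} → KappaJoin m j → (p : IsMI m) → z ≤ proj₁ p → ¬ z ≤ m → j ≤ z
  κ-least {z = z} (p' , minimal , _) p z≤m⁺ z≰m =
    minimal⇒least p' minimal (subst (z ≤_) (upperCover-unique p p') z≤m⁺ , z≰m)

  κ-unique : ∀ {m j j'} → KappaJoin m j → KappaJoin m j' → j ≡ j'
  κ-unique k k'@(p , _) =
    ≤-antisym (κ-least k p (κ≤upperCover k' p) (κ≰ k')) (κ-least k' p (κ≤upperCover k p) (κ≰ k))

  <κ⇒≤ : ∀ {m j z} → KappaJoin m j → z < j → z ≤ m
  <κ⇒≤ k@(p , _) z<j =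
    ≤-stable λ z≰m → <⇒≱ z<j (κ-least k p (≤-trans (proj₁ z<j) (κ≤upperCover k p)) z≰m)

  κ-isJI : ∀ {m j} → KappaJoin m j → IsJI j
  κ-isJI k = greatest-below⇒JI (≰⇒∧< (κ≰ k)) λ z<j → ∧-greatest (proj₁ z<j) (<κ⇒≤ k z<j)

  lowerCover≤ : ∀ {m j} → KappaJoin m j → (q : IsJI j) → proj₁ q ≤ m
  lowerCover≤ k q = <κ⇒≤ k (lowerCover< q)

  κ-greatest : ∀ {m j z} → KappaJoin m j → (q : IsJI j) → proj₁ q ≤ z → ¬ j ≤ z → z ≤ m
  κ-greatest {m} {j} {z} k@(p , _) q j₋≤z j≰z = ≤-stable λ z≰m → <⇒≱ (lowerCover< q) (begin
    j                ≤⟨ ∧-greatest ≤-refl (≤-trans (κ≤upperCover k p) (upperCover≤ p (≰⇒<∨ z≰m))) ⟩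
    j ∧ (m ∨ z)      ≡⟨ ∧-semidistributive (trans j∧m≡j₋ (sym (meet-lowerCover q j₋≤z j≰z))) ⟩
    j ∧ m            ≡⟨ j∧m≡j₋ ⟩
    proj₁ q          ∎)
    where
    open PosetReasoning poset
    j∧m≡j₋ : j ∧ m ≡ proj₁ q
    j∧m≡j₋ = meet-lowerCover q (lowerCover≤ k q) (κ≰ k)

  KappaJoin⇒KappaMeet : ∀ {m j} → KappaJoin m j → KappaMeet j m
  KappaJoin⇒KappaMeet {m} {j} k =
    q , (avoiding-m , λ w (j₋≤w , j≰w) m≤w → ≤-antisym (κ-greatest k q j₋≤w j≰w) m≤w) ,
    λ w ((j₋≤w , j≰w) , maximal) → sym (maximal m avoiding-m (κ-greatest k q j₋≤w j≰w))
    where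
    q : IsJI j
    q = κ-isJI k
    avoiding-m : proj₁ q ≤ m × ¬ j ≤ m
    avoiding-m = lowerCover≤ k q , κ≰ k

  κ≤CMR-member : ∀ {x M a a' j'} → IsCMR x M → a ∈ M → a' ∈ M → a ≢ a' →
                 KappaJoin a' j' → j' ≤ a
  κ≤CMR-member {M = M} {a' = a'} cmr a∈M a'∈M a≢a' k@(p , _) =
    ≤-trans (κ-least k p (x∧y≤x _ _) a'⁺∧rest≰a')
            (≤-trans (x∧y≤y _ _) (Lᵒᵖ.⋁-upperBound (M Lᵒᵖ.∖ a') (Lᵒᵖ.∈-∖⁺ a∈M a≢a')))
    where
    a'⁺∧rest≰a' : ¬ proj₁ p ∧ ⋀ (M Lᵒᵖ.∖ a') ≤ a'
    a'⁺∧rest≰a' = Lᵒᵖ.CJR⇒≰lowerCover∨rest cmr a'∈M (MI⇒JIᵒᵖ p)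

  κ[CMR]⇒CJR : ∀ {x M J} → IsCMR x M → (∀ j → j ∈ J → ∃[ a ] (a ∈ M × KappaJoin a j)) →
               IsCJR (⋁ J) J
  κ[CMR]⇒CJR {M = M} {J} cmr preimage = ≰lowerCover∨rest⇒CJR (proj₁ (sd _)) criterion
    where
    criterion : ∀ {j} → j ∈ J → Σ (IsJI j) λ q → ¬ j ≤ proj₁ q ∨ ⋁ (J ∖ j)
    criterion {j} j∈J with preimage j j∈J
    ... | a , a∈M , k = q , λ j≤j₋∨rest → κ≰ k (≤-trans j≤j₋∨rest j₋∨rest≤a)
      where
      q : IsJI j
      q = κ-isJI k

      rest≤a : ∀ {j'} → j' ∈ J ∖ j → j' ≤ a
      rest≤a {j'} j'∈rest with preimage j' (∖-⊆ j'∈rest)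
      ... | a' , a'∈M , k' =
        κ≤CMR-member cmr a∈M a'∈M (λ { refl → ∈-∖⁻ j'∈rest (κ-unique k' k) }) k'

      j₋∨rest≤a : proj₁ q ∨ ⋁ (J ∖ j) ≤ a
      j₋∨rest≤a = ∨-least (lowerCover≤ k q) (⋁-least (J ∖ j) rest≤a)

  module _ {Θ : Rel Carrier 0ℓ} (cg : IsCongruence Θ) where
    open IsCongruence cg using (isEquivalence; ∨-cong)
    open IsEquivalence isEquivalence using () renaming (refl to Θ-refl; sym to Θ-sym)

    κ-uncontracted : ∀ {m j} → KappaJoin m j → UMI Θ m → UJI Θ j
    κ-uncontracted {m} {j} k (p , ¬θ) =
      q , λ θ → ¬θ (Θ-sym (subst₂ Θ m∨j≡m⁺ m∨j₋≡m (∨-cong Θ-refl θ)))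
      where
      q : IsJI j
      q = κ-isJI k

      m∨j≡m⁺ : m ∨ j ≡ proj₁ p
      m∨j≡m⁺ = join-upperCover p (κ≤upperCover k p) (κ≰ k)

      m∨j₋≡m : m ∨ proj₁ q ≡ m
      m∨j₋≡m = y≤x⇒x∨y≡x (lowerCover≤ k q)

module Uncontracted (L : FinLattice) (sd : Theory.Semidistributive L)
                    {Θ : Rel (FinLattice.Carrier L) 0ℓ} (cg : Theory.IsCongruence L Θ) where
  open FinLattice L
  open Theory L
  open Kappa L sd
  open Duality L
  open Duality (dual L) using () renaming
    (UJI⇒UMIᵒᵖ to UJIᵒᵖ⇒UMI; KappaMeet⇒KappaJoinᵒᵖ to KappaMeetᵒᵖ⇒KappaJoin;
     KappaJoin⇒KappaMeetᵒᵖ to KappaJoinᵒᵖ⇒KappaMeet)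
  private module Kᵒᵖ = Kappa (dual L) (semidistributiveᵒᵖ sd)

  κ∧-exists : ∀ {j} → IsJI j → ∃[ m ] KappaMeet j m
  κ∧-exists q = map₂ KappaJoinᵒᵖ⇒KappaMeet (Kᵒᵖ.κ-exists (JI⇒MIᵒᵖ q))

  KappaMeet⇒KappaJoin : ∀ {j m} → KappaMeet j m → KappaJoin m j
  KappaMeet⇒KappaJoin = KappaMeetᵒᵖ⇒KappaJoin ∘ Kᵒᵖ.KappaJoin⇒KappaMeet ∘ KappaMeet⇒KappaJoinᵒᵖ

  κ∧-uncontracted : ∀ {j m} → KappaMeet j m → UJI Θ j → UMI Θ m
  κ∧-uncontracted κ u =
    UJIᵒᵖ⇒UMI {Θ} (Kᵒᵖ.κ-uncontracted (congruenceᵒᵖ cg) (KappaMeet⇒KappaJoinᵒᵖ κ) (UJI⇒UMIᵒᵖ {Θ} u))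

  UJI⇔κ[UMI] : ∀ j → UJI Θ j ⇔ (∃[ m ] (UMI Θ m × KappaJoin m j))
  UJI⇔κ[UMI] j = mk⇔ to λ (m , u , k) → κ-uncontracted cg k u
    where
    to : UJI Θ j → ∃[ m ] (UMI Θ m × KappaJoin m j)
    to u@(q , _) = let m , κ = κ∧-exists q in m , κ∧-uncontracted κ u , KappaMeet⇒KappaJoin κ

  κ-face : ∀ M J → IsCMCFace Θ M → Image KappaJoin M J → IsCJCFace Θ J
  κ-face M J ((_ , cmr) , uncontracted) (preimage , _) =
    (⋁ J , κ[CMR]⇒CJR cmr preimage) ,
    λ j j∈J → let a , a∈M , k = preimage j j∈J in κ-uncontracted cg k (uncontracted a a∈M)

module UncontractedDual (L : FinLattice) (sd : Theory.Semidistributive L)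
                        {Θ : Rel (FinLattice.Carrier L) 0ℓ} (cg : Theory.IsCongruence L Θ) where
  open Theory L
  open Duality L
  open Duality (dual L) using () renaming
    (UJI⇒UMIᵒᵖ to UJIᵒᵖ⇒UMI; UMI⇒UJIᵒᵖ to UMIᵒᵖ⇒UJI;
     KappaJoin⇒KappaMeetᵒᵖ to KappaJoinᵒᵖ⇒KappaMeet; CJCFace⇒CMCFaceᵒᵖ to CJCFaceᵒᵖ⇒CMCFace)
  private module Uᵒᵖ = Uncontracted (dual L) (semidistributiveᵒᵖ sd) (congruenceᵒᵖ cg)

  UMI⇔κ∧[UJI] : ∀ m → UMI Θ m ⇔ (∃[ j ] (UJI Θ j × KappaMeet j m))
  UMI⇔κ∧[UJI] m = mk⇔
    (λ u → map₂ (map (UMIᵒᵖ⇒UJI {Θ}) KappaJoinᵒᵖ⇒KappaMeet) (to (UMI⇒UJIᵒᵖ {Θ} u)))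
    (λ (j , u , κ) → UJIᵒᵖ⇒UMI {Θ} (from (j , UJI⇒UMIᵒᵖ {Θ} u , KappaMeet⇒KappaJoinᵒᵖ κ)))
    where open Equivalence (Uᵒᵖ.UJI⇔κ[UMI] m)

  κ∧-face : ∀ J M → IsCJCFace Θ J → Image KappaMeet J M → IsCMCFace Θ M
  κ∧-face J M face image =
    CJCFaceᵒᵖ⇒CMCFace
      (Uᵒᵖ.κ-face J M (CJCFace⇒CMCFaceᵒᵖ face) (Image-map KappaMeet⇒KappaJoinᵒᵖ image))

proposition2p17 : (L : FinLattice) →
  let open FinLattice L
      open Theory L
  in Semidistributive →
     (Θ : Rel Carrier 0ℓ) → IsCongruence Θ → Decidable Θ →
     -- UJI_≡ = κ_∨(UMI_≡)
     (∀ j → UJI Θ j ⇔ (∃[ m ] (UMI Θ m × KappaJoin m j))) ×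
     -- UMI_≡ = κ_∧(UJI_≡)
     (∀ m → UMI Θ m ⇔ (∃[ j ] (UJI Θ j × KappaMeet j m))) ×
     -- κ_∨ and κ_∧ are mutually inverse on these vertex sets
     (∀ m j → UMI Θ m → (KappaJoin m j ⇔ KappaMeet j m)) ×
     -- κ_∨ maps faces of CMC_≡ to faces of CJC_≡
     (∀ M J → IsCMCFace Θ M → Image KappaJoin M J → IsCJCFace Θ J) ×
     -- κ_∧ maps faces of CJC_≡ to faces of CMC_≡
     (∀ J M → IsCJCFace Θ J → Image KappaMeet J M → IsCMCFace Θ M)
proposition2p17 L sd Θ cg _ =
  UJI⇔κ[UMI] ,
  UMI⇔κ∧[UJI] ,
  (λ _ _ _ → mk⇔ KappaJoin⇒KappaMeet KappaMeet⇒KappaJoin) ,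
  κ-face ,
  κ∧-face
  where
  open Kappa L sd using (KappaJoin⇒KappaMeet)
  open Uncontracted L sd cg
  open UncontractedDual L sd cg
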